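{- The subgroup of $a\mathcal R$ consisting of all almost-Riordan arrays of the form $\left(g,\ g\frac{f}{x},\ f\right)$ (which is isomorphic to the Riordan group $\mathcal R$ via $\left(g,g\frac{f}{x},f\right)\mapsto(g,f)$) is not a normal subgroup of $a\mathcal R$.
   Context: All power series have integer coefficients. An almost-Riordan array is an ordered triple $(a,g,f)$ of power series with $a_0=1$, $g_0=1$, $f_0=0$, $f_1=1$, identified with the infinite lower-triangular matrix $M$ given by $M_{n,0}=a_n$, $M_{0,k}=0$ for $k\ge1$, $M_{n,k}=[x^{n-1}]g(x)f(x)^{k-1}$ for $n,k\ge1$. For a power series $h$, $(a,g,f)\cdot h$ is the power series whose coefficient sequence is $M(h_0,h_1,\dots)^T$. The group $a\mathcal R$ is the set of almost-Riordan arrays with product $(a,g,f)\cdot(b,u,v)=\big((a,g,f)\cdot b,\ g\,u(f),\ v(f)\big)$ and identity $(1,1,x)$. The Riordan group $\mathcal R$ is the set of pairs $(g,f)$ with $g_0=1$, $f_0=0$, $f_1=1$ and product $(g,f)\cdot(u,v)=(g\,u(f),v(f))$. -}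

module Defs where

open import Data.Nat using (ℕ; zero; suc; _∸_)
open import Data.Integer using (ℤ; 0ℤ; 1ℤ; _+_; _*_)
open import Data.Product using (_×_; _,_)
open import Relation.Binary.PropositionalEquality using (_≡_)

PS : Set
PS = ℕ → ℤ

_≈ₚ_ : PS → PS → Set
a ≈ₚ b = ∀ n → a n ≡ b n

sumTo : ℕ → (ℕ → ℤ) → ℤ
sumTo zero    t = 0ℤ
sumTo (suc n) t = sumTo n t + t n

oneₚ : PS
oneₚ zero    = 1ℤ
oneₚ (suc _) = 0ℤ

xₚ : PS
xₚ zero          = 0ℤ
xₚ (suc zero)    = 1ℤ
xₚ (suc (suc _)) = 0ℤ

_⊛_ : PS → PS → PS
(a ⊛ b) n = sumTo (suc n) (λ i → a i * b (n ∸ i))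

pow : PS → ℕ → PS
pow f zero    = oneₚ
pow f (suc k) = pow f k ⊛ f

-- composition u(f), meaningful when f₀ = 0:  [xⁿ] u(f) = Σ_{k ≤ n} u_k [xⁿ] f^k
_∘ₚ_ : PS → PS → PS
(u ∘ₚ f) n = sumTo (suc n) (λ k → u k * pow f k n)

-- f / x  (for f with f₀ = 0)
divx : PS → PS
divx f n = f (suc n)

ARA : Set
ARA = PS × PS × PS

IsARA : ARA → Set
IsARA (a , g , f) = (a 0 ≡ 1ℤ) × (g 0 ≡ 1ℤ) × (f 0 ≡ 0ℤ) × (f 1 ≡ 1ℤ)

-- The action (a,g,f)·h : coefficients of M (h₀,h₁,…)ᵀ where
-- M_{n,0} = a_n, M_{0,k} = 0 (k ≥ 1), M_{n,k} = [x^{n-1}] g f^{k-1} (n,k ≥ 1).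
act : ARA → PS → PS
act (a , g , f) h zero    = a 0 * h 0
act (a , g , f) h (suc n) =
  a (suc n) * h 0 + sumTo (suc n) (λ j → (g ⊛ pow f j) n * h (suc j))

_⊗_ : ARA → ARA → ARA
(a , g , f) ⊗ (b , u , v) = act (a , g , f) b , g ⊛ (u ∘ₚ f) , v ∘ₚ f

idA : ARA
idA = oneₚ , oneₚ , xₚ

_≈A_ : ARA → ARA → Set
(a , g , f) ≈A (b , u , v) = (a ≈ₚ b) × (g ≈ₚ u) × (f ≈ₚ v)

-- Membership in the subgroup { (g, g f/x, f) }
InH : ARA → Set
InH (a , g , f) = g ≈ₚ (a ⊛ divx f)

HNormal : Set
HNormal = ∀ (A B h : ARA) → IsARA A → IsARA B → IsARA h
        → (A ⊗ B) ≈A idA → (B ⊗ A) ≈A idA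
        → InH h → InH ((A ⊗ h) ⊗ B)

-- Conjugating h = (1, 1 + x, x + x²) ∈ H by the array (1 + x, 1, x), whose inverse is
-- (1 − x, 1, x), gives (1 − x², 1 + x, x + x²).  This lies outside H, because
-- (1 − x²)·(x + x²)/x = 1 + x − x² − x³ differs from 1 + x in the coefficient of x².
module Submission where

open import Defs
open import Relation.Nullary using (¬_)
open import Data.Integer using (ℤ; 0ℤ; 1ℤ; -1ℤ; _+_; _*_)
open import Data.Integer.Properties
  using (+-identityˡ; +-identityʳ; *-zeroˡ; *-zeroʳ; *-identityˡ; *-identityʳ; *-comm; +-assoc)
open import Data.Nat using (ℕ; zero; suc; _∸_; _<_; s<s)
open import Data.Nat.Properties using (n∸n≡0; n<1+n; m<n⇒m<1+n)
open import Data.Product using (_,_)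
open import Relation.Binary.PropositionalEquality
open ≡-Reasoning

sumTo-cong : ∀ n {s t : ℕ → ℤ} → (∀ i → s i ≡ t i) → sumTo n s ≡ sumTo n t
sumTo-cong zero    s≡t = refl
sumTo-cong (suc n) s≡t = cong₂ _+_ (sumTo-cong n s≡t) (s≡t n)

sumTo-zero : ∀ n {t : ℕ → ℤ} → (∀ i → i < n → t i ≡ 0ℤ) → sumTo n t ≡ 0ℤ
sumTo-zero zero    t≡0 = refl
sumTo-zero (suc n) t≡0 =
  cong₂ _+_ (sumTo-zero n (λ i i<n → t≡0 i (m<n⇒m<1+n i<n))) (t≡0 n (n<1+n n))

sumTo-head : ∀ n (t : ℕ → ℤ) → sumTo (suc n) t ≡ t 0 + sumTo n (λ i → t (suc i))
sumTo-head zero    t = trans (+-identityˡ (t 0)) (sym (+-identityʳ (t 0)))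
sumTo-head (suc n) t = begin
  sumTo (suc n) t + t (suc n)                   ≡⟨ cong (_+ t (suc n)) (sumTo-head n t) ⟩
  (t 0 + sumTo n (λ i → t (suc i))) + t (suc n) ≡⟨ +-assoc (t 0) _ _ ⟩
  t 0 + sumTo (suc n) (λ i → t (suc i))         ∎

sumTo-last : ∀ n {t : ℕ → ℤ} → (∀ i → i < n → t i ≡ 0ℤ) → sumTo (suc n) t ≡ t n
sumTo-last n {t} t≡0 = trans (cong (_+ t n) (sumTo-zero n t≡0)) (+-identityˡ (t n))

sumTo-first : ∀ n {t : ℕ → ℤ} → (∀ i → t (suc i) ≡ 0ℤ) → sumTo (suc n) t ≡ t 0
sumTo-first n {t} t≡0 = begin
  sumTo (suc n) t                  ≡⟨ sumTo-head n t ⟩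
  t 0 + sumTo n (λ i → t (suc i))  ≡⟨ cong (t 0 +_) (sumTo-zero n (λ i _ → t≡0 i)) ⟩
  t 0 + 0ℤ                         ≡⟨ +-identityʳ (t 0) ⟩
  t 0                              ∎

⊛-identityˡ : ∀ p → (oneₚ ⊛ p) ≈ₚ p
⊛-identityˡ p n = begin
  sumTo (suc n) (λ i → oneₚ i * p (n ∸ i)) ≡⟨ sumTo-first n (λ i → *-zeroˡ (p (n ∸ suc i))) ⟩
  1ℤ * p n                                 ≡⟨ *-identityˡ (p n) ⟩
  p n                                      ∎

monomial : ℕ → PS
monomial zero    zero    = 1ℤ
monomial zero    (suc n) = 0ℤ
monomial (suc k) zero    = 0ℤ
monomial (suc k) (suc n) = monomial k n

monomial-diag : ∀ n → monomial n n ≡ 1ℤ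
monomial-diag zero    = refl
monomial-diag (suc n) = monomial-diag n

monomial-< : ∀ {k n} → k < n → monomial k n ≡ 0ℤ
monomial-< {zero}  {suc n} _         = refl
monomial-< {suc k} {suc n} (s<s k<n) = monomial-< k<n

xₚ-< : ∀ {i m} → i < m → xₚ (suc m ∸ i) ≡ 0ℤ
xₚ-< {zero}  {suc m} _         = refl
xₚ-< {suc i} {suc m} (s<s i<m) = xₚ-< i<m

⊛xₚ-zero : ∀ q → (q ⊛ xₚ) 0 ≡ 0ℤ
⊛xₚ-zero q = trans (+-identityˡ _) (*-zeroʳ (q 0))

⊛xₚ-suc : ∀ q m → (q ⊛ xₚ) (suc m) ≡ q m
⊛xₚ-suc q m = begin
  sumTo (suc m) t + q (suc m) * xₚ (m ∸ m) ≡⟨ cong₂ _+_ (sumTo-last m t<m≡0) last≡0 ⟩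
  t m + 0ℤ                                 ≡⟨ +-identityʳ (t m) ⟩
  q m * xₚ (suc m ∸ m)                     ≡⟨ cong (λ j → q m * xₚ j) (sm∸m≡1 m) ⟩
  q m * 1ℤ                                 ≡⟨ *-identityʳ (q m) ⟩
  q m                                      ∎
  where
  t : ℕ → ℤ
  t i = q i * xₚ (suc m ∸ i)
  t<m≡0 : ∀ i → i < m → t i ≡ 0ℤ
  t<m≡0 i i<m = trans (cong (q i *_) (xₚ-< i<m)) (*-zeroʳ (q i))
  last≡0 : q (suc m) * xₚ (m ∸ m) ≡ 0ℤ
  last≡0 = trans (cong (λ j → q (suc m) * xₚ j) (n∸n≡0 m)) (*-zeroʳ (q (suc m)))
  sm∸m≡1 : ∀ m → suc m ∸ m ≡ 1
  sm∸m≡1 zero    = refl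
  sm∸m≡1 (suc m) = sm∸m≡1 m

pow-xₚ : ∀ k → pow xₚ k ≈ₚ monomial k
pow-xₚ zero    zero    = refl
pow-xₚ zero    (suc n) = refl
pow-xₚ (suc k) zero    = ⊛xₚ-zero (pow xₚ k)
pow-xₚ (suc k) (suc n) = trans (⊛xₚ-suc (pow xₚ k) n) (pow-xₚ k n)

sumTo-monomial : ∀ n (c : ℕ → ℤ) → sumTo (suc n) (λ j → monomial j n * c j) ≡ c n
sumTo-monomial n c = begin
  sumTo (suc n) (λ j → monomial j n * c j) ≡⟨ sumTo-last n (λ j j<n → trans (cong (_* c j) (monomial-< j<n)) (*-zeroˡ (c j))) ⟩
  monomial n n * c n                       ≡⟨ cong (_* c n) (monomial-diag n) ⟩
  1ℤ * c n                                 ≡⟨ *-identityˡ (c n) ⟩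
  c n                                      ∎

∘ₚ-identityʳ : ∀ u → (u ∘ₚ xₚ) ≈ₚ u
∘ₚ-identityʳ u n = begin
  sumTo (suc n) (λ k → u k * pow xₚ k n)    ≡⟨ sumTo-cong (suc n) (λ k → cong (u k *_) (pow-xₚ k n)) ⟩
  sumTo (suc n) (λ k → u k * monomial k n)  ≡⟨ sumTo-cong (suc n) (λ k → *-comm (u k) (monomial k n)) ⟩
  sumTo (suc n) (λ k → monomial k n * u k)  ≡⟨ sumTo-monomial n u ⟩
  u n                                       ∎

∘ₚ-identityˡ : ∀ f → f 0 ≡ 0ℤ → (xₚ ∘ₚ f) ≈ₚ f
∘ₚ-identityˡ f f₀≡0 zero    = trans (+-identityˡ _) (trans (*-zeroˡ 1ℤ) (sym f₀≡0))
∘ₚ-identityˡ f f₀≡0 (suc m) = begin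
  sumTo (suc (suc m)) (λ k → xₚ k * pow f k (suc m))
    ≡⟨ sumTo-head (suc m) _ ⟩
  0ℤ * pow f 0 (suc m) + sumTo (suc m) (λ i → xₚ (suc i) * pow f (suc i) (suc m))
    ≡⟨ cong₂ _+_ (*-zeroˡ (pow f 0 (suc m))) (sumTo-first m (λ i → *-zeroˡ (pow f (suc (suc i)) (suc m)))) ⟩
  0ℤ + 1ℤ * (oneₚ ⊛ f) (suc m)
    ≡⟨ trans (+-identityˡ _) (*-identityˡ _) ⟩
  (oneₚ ⊛ f) (suc m)
    ≡⟨ ⊛-identityˡ f (suc m) ⟩
  f (suc m) ∎

act-unipotent : ∀ a b n → act (a , oneₚ , xₚ) b (suc n) ≡ a (suc n) * b 0 + b (suc n)
act-unipotent a b n = cong (a (suc n) * b 0 +_) (begin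
  sumTo (suc n) (λ j → (oneₚ ⊛ pow xₚ j) n * b (suc j))
    ≡⟨ sumTo-cong (suc n) (λ j → cong (_* b (suc j)) (trans (⊛-identityˡ (pow xₚ j) n) (pow-xₚ j n))) ⟩
  sumTo (suc n) (λ j → monomial j n * b (suc j))
    ≡⟨ sumTo-monomial n (λ j → b (suc j)) ⟩
  b (suc n) ∎)

-- (a, 1, x) is the matrix with first column a over the identity, so these multiply by adding first columns.
unipotent-inverse : ∀ a b → a 0 ≡ 1ℤ → b 0 ≡ 1ℤ → (∀ n → a (suc n) + b (suc n) ≡ 0ℤ)
                  → ((a , oneₚ , xₚ) ⊗ (b , oneₚ , xₚ)) ≈A idA
unipotent-inverse a b a₀≡1 b₀≡1 a+b≡0 = firstColumn , g≈1 , ∘ₚ-identityˡ xₚ refl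
  where
  firstColumn : act (a , oneₚ , xₚ) b ≈ₚ oneₚ
  firstColumn zero    = cong₂ _*_ a₀≡1 b₀≡1
  firstColumn (suc n) = begin
    act (a , oneₚ , xₚ) b (suc n) ≡⟨ act-unipotent a b n ⟩
    a (suc n) * b 0 + b (suc n)   ≡⟨ cong (λ c → a (suc n) * c + b (suc n)) b₀≡1 ⟩
    a (suc n) * 1ℤ + b (suc n)    ≡⟨ cong (_+ b (suc n)) (*-identityʳ (a (suc n))) ⟩
    a (suc n) + b (suc n)         ≡⟨ a+b≡0 n ⟩
    0ℤ                            ∎
  g≈1 : (oneₚ ⊛ (oneₚ ∘ₚ xₚ)) ≈ₚ oneₚ
  g≈1 n = trans (⊛-identityˡ (oneₚ ∘ₚ xₚ) n) (∘ₚ-identityʳ oneₚ n)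

1+x 1-x x+x² : PS
1+x 0 = 1ℤ
1+x 1 = 1ℤ
1+x _ = 0ℤ

1-x 0 = 1ℤ
1-x 1 = -1ℤ
1-x _ = 0ℤ

x+x² 0 = 0ℤ
x+x² 1 = 1ℤ
x+x² 2 = 1ℤ
x+x² _ = 0ℤ

1+x⁻¹ : ((1+x , oneₚ , xₚ) ⊗ (1-x , oneₚ , xₚ)) ≈A idA
1+x⁻¹ = unipotent-inverse 1+x 1-x refl refl λ { zero → refl ; (suc _) → refl }

1-x⁻¹ : ((1-x , oneₚ , xₚ) ⊗ (1+x , oneₚ , xₚ)) ≈A idA
1-x⁻¹ = unipotent-inverse 1-x 1+x refl refl λ { zero → refl ; (suc _) → refl }

1+x∈H : InH (oneₚ , 1+x , x+x²)
1+x∈H n = trans (1+x≡x+x²/x n) (sym (⊛-identityˡ (divx x+x²) n))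
  where
  1+x≡x+x²/x : 1+x ≈ₚ divx x+x²
  1+x≡x+x²/x 0             = refl
  1+x≡x+x²/x 1             = refl
  1+x≡x+x²/x (suc (suc _)) = refl

conjugate-∉H : ¬ InH (((1+x , oneₚ , xₚ) ⊗ (oneₚ , 1+x , x+x²)) ⊗ (1-x , oneₚ , xₚ))
conjugate-∉H ∈H with ∈H 2
... | ()

mainTheorem9 : ¬ HNormal
mainTheorem9 normal = conjugate-∉H
  (normal (1+x , oneₚ , xₚ) (1-x , oneₚ , xₚ) (oneₚ , 1+x , x+x²)
          (refl , refl , refl , refl) (refl , refl , refl , refl) (refl , refl , refl , refl)
          1+x⁻¹ 1-x⁻¹ 1+x∈H)
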